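{- Let $\mathcal{K}=(D,X,H,f)$ be a configuration. Let $T$ be a partial transversal of $(X,H)$ such that $H[T]$ is strictly $f$-degenerate and $D'=D-\mathrm{dom}(T:D)$ is connected. Let $(X',H')$ be the restriction of $(X,H)$ to $D'$ (i.e. $X'_v=X_v$ for $v\in V(D')$ and $H'=H[\bigcup_{v\in V(D')}X_v]$), and define $f':V(H')\to\mathbb{N}_0^2$ by $$f'^+(x)=\max\Big\{0,f^+(x)-\sum_{y\in T}a_H(x,y)\Big\},\qquad f'^-(x)=\max\Big\{0,f^-(x)-\sum_{y\in T}a_H(y,x)\Big\}.$$ Let $\mathcal{K}'=(D',X',H',f')$. Then (a) if $\mathcal{K}$ is degree-feasible, so is $\mathcal{K}'$; and (b) if $\mathcal{K}$ is uncolorable, so is $\mathcal{K}'$.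
   Context: Digraphs are finite, without loops and parallel arcs (digons allowed); $d_D(v)=(d^+_D(v),d^-_D(v))$; pairs in $\mathbb{N}_0^2$ compared and added coordinatewise; $a_H(x,y)=1$ if $xy\in A(H)$ and $0$ otherwise; connected refers to the underlying graph. Cover of $D$: pair $(X,H)$, $H$ disjoint from $D$, $X_v\subseteq V(H)$ pairwise disjoint with union $V(H)$, each independent, arcs from $X_u$ to $X_v$ ($u\ne v$) a matching if $uv\in A(D)$, none otherwise. Transversal: $|T\cap X_v|=1$ for all $v$; partial transversal: $|T\cap X_v|\le1$; $\mathrm{dom}(T:D)=\{v:X_v\cap T\ne\varnothing\}$. For $f:V(H)\to\mathbb{N}_0^2$, $f=(f^+,f^-)$, $f(Y)=\sum_{y\in Y}f(y)$; $H$ is strictly $f$-degenerate if every nonempty subdigraph $H''$ of $H$ has a vertex $x$ with $d^+_{H''}(x)<f^+(x)$ or $d^-_{H''}(x)<f^-(x)$. A configuration $(D,X,H,f)$: $(X,H)$ a cover of $D$, $f:V(H)\to\mathbb{N}_0^2$; degree-feasible if $f(X_v)\ge d_D(v)$ for all $v$; colorable if some transversal $T$ has $H[T]$ strictly $f$-degenerate; uncolorable otherwise. -}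

module Defs where

open import Data.Nat using (ℕ; _+_; _∸_; _≤_; _<_)
open import Data.Fin using (Fin; _≟_)
open import Data.Bool using (Bool; true; false; _∧_; _∨_; not; if_then_else_)
open import Data.List using (List; allFin; foldr)
open import Data.Product using (Σ; ∃; _×_; _,_; proj₁; proj₂)
open import Data.Sum using (_⊎_)
open import Relation.Nullary using (¬_; does)
open import Relation.Binary.PropositionalEquality using (_≡_; _≢_)

sumWhere : ∀ {m} → (Fin m → Bool) → (Fin m → ℕ) → ℕ
sumWhere {m} P g = foldr (λ i acc → (if P i then g i else 0) + acc) 0 (allFin m)

count : ∀ {m} → (Fin m → Bool) → ℕ
count P = sumWhere P (λ _ → 1)

anyFin : ∀ {m} → (Fin m → Bool) → Bool
anyFin {m} P = foldr (λ i acc → P i ∨ acc) false (allFin m)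

_==_ : ∀ {n} → Fin n → Fin n → Bool
x == y = does (x ≟ y)

-- Arcs of the digraph are the pairs (x,y) with both ends in `vert` and
-- arc x y = true.  A Bool relation excludes parallel arcs; digons allowed.
-- Representing vertex sets as subsets of an ambient Fin lets induced
-- subdigraphs (D - S, H[T], ...) be formed by shrinking `vert`.

record Digraph : Set where
  field
    size     : ℕ
    arc      : Fin size → Fin size → Bool
    loopless : ∀ v → arc v v ≡ false
    vert     : Fin size → Bool
open Digraph public

adj : (G : Digraph) → Fin (size G) → Fin (size G) → Bool
adj G x y = vert G x ∧ vert G y ∧ arc G x y

outdeg indeg : (G : Digraph) → Fin (size G) → ℕ
outdeg G v = count (λ w → adj G v w)
indeg  G v = count (λ w → adj G w v)

induced : (G : Digraph) → (Fin (size G) → Bool) → Digraph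
induced G S = record G { vert = λ v → vert G v ∧ S v }

delete : (G : Digraph) → (Fin (size G) → Bool) → Digraph
delete G S = induced G (λ v → not (S v))

data Walk (G : Digraph) : Fin (size G) → Fin (size G) → Set where
  here : ∀ {u} → Walk G u u
  step : ∀ {u v w} → Walk G u v →
         (adj G v w ≡ true ⊎ adj G w v ≡ true) → Walk G u w

Connected : Digraph → Set
Connected G = ∀ u v → vert G u ≡ true → vert G v ≡ true → Walk G u v

StrictlyDegenerate : (G : Digraph) → (Fin (size G) → ℕ × ℕ) → Set
StrictlyDegenerate G f =
  (S : Fin (size G) → Bool) (B : Fin (size G) → Fin (size G) → Bool) →
  (∀ x → S x ≡ true → vert G x ≡ true) →
  (∀ x y → B x y ≡ true → (S x ≡ true × S y ≡ true × arc G x y ≡ true)) →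
  (∃ λ x → S x ≡ true) →
  ∃ λ x → S x ≡ true ×
    (count (λ y → B x y) < proj₁ (f x) ⊎ count (λ y → B y x) < proj₂ (f x))

-- The cover (X,H) is encoded by a map p : V(H) → V(D)
-- with X_v = { x ∈ V(H) | p x = v }; these are automatically pairwise
-- disjoint, and their union over v ∈ V(D) is V(H) by `p-vert`.

record Config : Set where
  field
    D : Digraph
    H : Digraph
    p : Fin (size H) → Fin (size D)
    f : Fin (size H) → ℕ × ℕ
open Config public

record IsCover (K : Config) : Set where
  field
    p-vert      : ∀ x → vert (H K) x ≡ true → vert (D K) (p K x) ≡ true
    independent : ∀ x y → adj (H K) x y ≡ true → p K x ≢ p K y
    arcs-over   : ∀ x y → adj (H K) x y ≡ true → p K x ≢ p K y →
                  adj (D K) (p K x) (p K y) ≡ true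
    match-tail  : ∀ x y y' → adj (H K) x y ≡ true → adj (H K) x y' ≡ true →
                  p K y ≡ p K y' → y ≡ y'
    match-head  : ∀ x x' y → adj (H K) x y ≡ true → adj (H K) x' y ≡ true →
                  p K x ≡ p K x' → x ≡ x'

inX : (K : Config) → Fin (size (D K)) → Fin (size (H K)) → Bool
inX K v x = vert (H K) x ∧ (p K x == v)

f⁺ f⁻ : (K : Config) → Fin (size (H K)) → ℕ
f⁺ K x = proj₁ (f K x)
f⁻ K x = proj₂ (f K x)

DegreeFeasible : Config → Set
DegreeFeasible K = ∀ v → vert (D K) v ≡ true →
  outdeg (D K) v ≤ sumWhere (inX K v) (f⁺ K) ×
  indeg  (D K) v ≤ sumWhere (inX K v) (f⁻ K)

PartialTransversal : (K : Config) → (Fin (size (H K)) → Bool) → Set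
PartialTransversal K T =
  (∀ x → T x ≡ true → vert (H K) x ≡ true) ×
  (∀ x y → T x ≡ true → T y ≡ true → p K x ≡ p K y → x ≡ y)

Transversal : (K : Config) → (Fin (size (H K)) → Bool) → Set
Transversal K T = PartialTransversal K T ×
  (∀ v → vert (D K) v ≡ true → ∃ λ x → T x ≡ true × p K x ≡ v)

Colorable : Config → Set
Colorable K = ∃ λ T → Transversal K T × StrictlyDegenerate (induced (H K) T) (f K)

Uncolorable : Config → Set
Uncolorable K = ¬ Colorable K

dom : (K : Config) → (Fin (size (H K)) → Bool) → Fin (size (D K)) → Bool
dom K T v = anyFin (λ x → T x ∧ inX K v x)

D′ : (K : Config) → (Fin (size (H K)) → Bool) → Digraph
D′ K T = delete (D K) (dom K T)

reduce : (K : Config) → (Fin (size (H K)) → Bool) → Config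
reduce K T = record
  { D = D′ K T
  ; H = induced (H K) (λ x → vert (D′ K T) (p K x))
  ; p = p K
  ; f = λ x → ( f⁺ K x ∸ count (λ y → T y ∧ adj (H K) x y)
              , f⁻ K x ∸ count (λ y → T y ∧ adj (H K) y x) )
  }

{-# OPTIONS --safe #-}
-- (a) For v in D′, the weight f(X_v) loses in passing to f′ is at most the number of arcs of H
-- between X_v and T (out- and in-arcs counted separately). Each such arc
-- lies over an arc of D between v and dom(T : D), injectively, since the arcs between two bags
-- form a matching and T meets each bag at most once. These are arcs that D loses at v in passing
-- to D′, so f′(X_v) ≥ d_{D′}(v) still holds.
-- (b) If a transversal T′ colours K′, then T ∪ T′ colours K. A subdigraph of H[T ∪ T′] inside T
-- is handled by H[T]; otherwise its part inside T′ has a vertex x beating f′, and x loses at most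
-- its arcs to T, which f′ discounts, so x beats f.
module Submission where

open import Defs
open import Algebra.Properties.CommutativeMonoid.Sum as Sum using ()
open import Data.Bool using (Bool; true; false; _∧_; _∨_; not; if_then_else_)
open import Data.Bool.Properties using (∧-identityʳ; ∧-zeroʳ; ∨-zeroʳ; not-injective)
open import Data.Empty using (⊥; ⊥-elim)
open import Data.Fin using (Fin; zero; suc; _≟_)
open import Data.Fin.Properties using (0≢1+n; suc-injective; any?)
open import Data.List using (foldr; tabulate)
open import Data.Nat using (ℕ; zero; suc; _+_; _∸_; _≤_; _<_; z≤n; s≤s)
open import Data.Nat.Properties
  using (≤-refl; ≤-reflexive; ≤-trans; +-mono-≤; +-monoˡ-≤; +-cancelˡ-≤;
         m≤m+n; m≤n+m; m≤n+m∸n; +-identityʳ; +-suc; +-0-commutativeMonoid; module ≤-Reasoning)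
open import Data.Product using (∃; _×_; _,_; proj₁; proj₂)
open import Data.Sum using (_⊎_; inj₁; inj₂) renaming (map to ⊎-map)
open import Function using (_∘_; id; flip; case_of_)
open import Relation.Nullary using (yes; no)
open import Relation.Nullary.Decidable using (dec-true)
open import Relation.Binary.PropositionalEquality
  using (_≡_; _≢_; refl; sym; trans; cong; cong₂; subst; module ≡-Reasoning)

open Sum +-0-commutativeMonoid
  using (sum-syntax; sum-cong-≗; sum-remove; sum-replicate-zero; ∑-distrib-+; ∑-comm)

𝟙 : Bool → ℕ
𝟙 b = if b then 1 else 0

AtMostOne : ∀ {m} → (Fin m → Bool) → Set
AtMostOne P = ∀ i j → P i ≡ true → P j ≡ true → i ≡ j

∧-true⁻ : ∀ x {y} → x ∧ y ≡ true → x ≡ true × y ≡ true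
∧-true⁻ true e = refl , e

∨-true⁻ : ∀ x {y} → x ∨ y ≡ true → x ≡ true ⊎ y ≡ true
∨-true⁻ true  _ = inj₁ refl
∨-true⁻ false e = inj₂ e

∨-trueˡ : ∀ {x y} → x ≡ true → x ∨ y ≡ true
∨-trueˡ refl = refl

∨-trueʳ : ∀ x {y} → y ≡ true → x ∨ y ≡ true
∨-trueʳ x refl = ∨-zeroʳ x

true≢false : true ≢ false
true≢false ()

==⇒≡ : ∀ {n} {x y : Fin n} → (x == y) ≡ true → x ≡ y
==⇒≡ {x = x} {y} e with x ≟ y
... | yes x≡y = x≡y
==⇒≡ () | no _

==-refl : ∀ {n} (x : Fin n) → (x == x) ≡ true
==-refl x = dec-true (x ≟ x) refl

∑-mono-≤ : ∀ {m} {g h : Fin m → ℕ} → (∀ i → g i ≤ h i) → ∑[ i < m ] g i ≤ ∑[ i < m ] h i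
∑-mono-≤ {zero}  _   = z≤n
∑-mono-≤ {suc m} g≤h = +-mono-≤ (g≤h zero) (∑-mono-≤ (g≤h ∘ suc))

term≤∑ : ∀ {m} (g : Fin m → ℕ) i → g i ≤ ∑[ j < m ] g j
term≤∑ {suc m} g i = ≤-trans (m≤m+n (g i) _) (≤-reflexive (sym (sum-remove {i = i} g)))

∑𝟙≡0 : ∀ {m} (P : Fin m → Bool) → (∀ i → P i ≢ true) → ∑[ i < m ] 𝟙 (P i) ≡ 0
∑𝟙≡0 {m} P none = trans (sum-cong-≗ vanishes) (sum-replicate-zero m)
  where
  vanishes : ∀ i → 𝟙 (P i) ≡ 0
  vanishes i with P i in e
  ... | true  = ⊥-elim (none i e)
  ... | false = refl

∑𝟙≤1 : ∀ {m} (P : Fin m → Bool) → AtMostOne P → ∑[ i < m ] 𝟙 (P i) ≤ 1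
∑𝟙≤1 {zero}  _ _ = z≤n
∑𝟙≤1 {suc m} P unique with P zero in P₀
... | true  = s≤s (≤-reflexive (∑𝟙≡0 (P ∘ suc) λ i Pᵢ → 0≢1+n (unique zero (suc i) P₀ Pᵢ)))
... | false = ∑𝟙≤1 (P ∘ suc) λ i j Pᵢ Pⱼ → suc-injective (unique (suc i) (suc j) Pᵢ Pⱼ)

private
  foldr-+-tabulate : ∀ {m n} (g : Fin n → ℕ) (f : Fin m → Fin n) →
    foldr (λ i acc → g i + acc) 0 (tabulate f) ≡ ∑[ i < m ] g (f i)
  foldr-+-tabulate {zero}  g f = refl
  foldr-+-tabulate {suc m} g f = cong (g (f zero) +_) (foldr-+-tabulate g (f ∘ suc))

  foldr-∨-tabulate⁺ : ∀ {m n} (P : Fin n → Bool) (f : Fin m → Fin n) i → P (f i) ≡ true →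
    foldr (λ j acc → P j ∨ acc) false (tabulate f) ≡ true
  foldr-∨-tabulate⁺ P f zero    e = ∨-trueˡ e
  foldr-∨-tabulate⁺ P f (suc i) e = ∨-trueʳ (P (f zero)) (foldr-∨-tabulate⁺ P (f ∘ suc) i e)

  foldr-∨-tabulate⁻ : ∀ {m n} (P : Fin n → Bool) (f : Fin m → Fin n) →
    foldr (λ j acc → P j ∨ acc) false (tabulate f) ≡ true → ∃ λ i → P (f i) ≡ true
  foldr-∨-tabulate⁻ {suc m} P f e with ∨-true⁻ (P (f zero)) e
  ... | inj₁ e₀ = zero , e₀
  ... | inj₂ e′ with foldr-∨-tabulate⁻ P (f ∘ suc) e′
  ...   | i , eᵢ = suc i , eᵢ

anyFin-intro : ∀ {m} (P : Fin m → Bool) i → P i ≡ true → anyFin P ≡ true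
anyFin-intro P = foldr-∨-tabulate⁺ P id

anyFin-elim : ∀ {m} (P : Fin m → Bool) → anyFin P ≡ true → ∃ λ i → P i ≡ true
anyFin-elim P = foldr-∨-tabulate⁻ P id

sumWhere≡∑ : ∀ {m} (P : Fin m → Bool) g → sumWhere P g ≡ ∑[ i < m ] (if P i then g i else 0)
sumWhere≡∑ P g = foldr-+-tabulate (λ i → if P i then g i else 0) id

count≡∑𝟙 : ∀ {m} (P : Fin m → Bool) → count P ≡ ∑[ i < m ] 𝟙 (P i)
count≡∑𝟙 P = sumWhere≡∑ P (λ _ → 1)

count-positive : ∀ {m} (P : Fin m → Bool) i → P i ≡ true → 0 < count P
count-positive P i Pᵢ = subst (0 <_) (sym (count≡∑𝟙 P))
  (≤-trans (≤-reflexive (cong 𝟙 (sym Pᵢ))) (term≤∑ (𝟙 ∘ P) i))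

count-≤-𝟙 : ∀ {m} {P : Fin m → Bool} {b} → AtMostOne P → (∀ i → P i ≡ true → b ≡ true) →
  count P ≤ 𝟙 b
count-≤-𝟙 {P = P} {true}  unique _   = subst (_≤ 1) (sym (count≡∑𝟙 P)) (∑𝟙≤1 P unique)
count-≤-𝟙 {P = P} {false} _      P⇒b =
  ≤-reflexive (trans (count≡∑𝟙 P) (∑𝟙≡0 P λ i Pᵢ → true≢false (sym (P⇒b i Pᵢ))))

count-≤-+ : ∀ {m} {P Q R : Fin m → Bool} → (∀ i → P i ≡ true → Q i ≡ true ⊎ R i ≡ true) →
  count P ≤ count Q + count R
count-≤-+ {m} {P} {Q} {R} P⊆Q∪R = begin
  count P                                    ≡⟨ count≡∑𝟙 P ⟩
  ∑[ i < m ] 𝟙 (P i)                         ≤⟨ ∑-mono-≤ (λ i → pointwise (P⊆Q∪R i)) ⟩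
  ∑[ i < m ] (𝟙 (Q i) + 𝟙 (R i))             ≡⟨ ∑-distrib-+ (𝟙 ∘ Q) (𝟙 ∘ R) ⟩
  ∑[ i < m ] 𝟙 (Q i) + ∑[ i < m ] 𝟙 (R i)    ≡⟨ sym (cong₂ _+_ (count≡∑𝟙 Q) (count≡∑𝟙 R)) ⟩
  count Q + count R                          ∎
  where
  open ≤-Reasoning
  pointwise : ∀ {p q r} → (p ≡ true → q ≡ true ⊎ r ≡ true) → 𝟙 p ≤ 𝟙 q + 𝟙 r
  pointwise {false} _ = z≤n
  pointwise {true} {q} p⇒q∨r with p⇒q∨r refl
  ... | inj₁ refl = s≤s z≤n
  ... | inj₂ refl = m≤n+m 1 (𝟙 q)

+-count-≤ : ∀ {m} {P Q R : Fin m → Bool} → (∀ i → Q i ≡ true → P i ≡ true) →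
  (∀ i → R i ≡ true → P i ≡ true) → (∀ i → Q i ≡ true → R i ≡ true → ⊥) →
  count Q + count R ≤ count P
+-count-≤ {m} {P} {Q} {R} Q⊆P R⊆P disjoint = begin
  count Q + count R                          ≡⟨ cong₂ _+_ (count≡∑𝟙 Q) (count≡∑𝟙 R) ⟩
  ∑[ i < m ] 𝟙 (Q i) + ∑[ i < m ] 𝟙 (R i)    ≡⟨ sym (∑-distrib-+ (𝟙 ∘ Q) (𝟙 ∘ R)) ⟩
  ∑[ i < m ] (𝟙 (Q i) + 𝟙 (R i))             ≤⟨ ∑-mono-≤ (λ i → pointwise (Q⊆P i) (R⊆P i) (disjoint i)) ⟩
  ∑[ i < m ] 𝟙 (P i)                         ≡⟨ sym (count≡∑𝟙 P) ⟩
  count P                                    ∎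
  where
  open ≤-Reasoning
  pointwise : ∀ {p q r} → (q ≡ true → p ≡ true) → (r ≡ true → p ≡ true) →
    (q ≡ true → r ≡ true → ⊥) → 𝟙 q + 𝟙 r ≤ 𝟙 p
  pointwise {q = true}  {true}  _   _   q∩r = ⊥-elim (q∩r refl refl)
  pointwise {q = true}  {false} q⇒p _   _   rewrite q⇒p refl = ≤-refl
  pointwise {q = false} {true}  _   r⇒p _   rewrite r⇒p refl = ≤-refl
  pointwise {q = false} {false} _   _   _   = z≤n

sumWhere-cong : ∀ {m} {P Q : Fin m → Bool} {g h : Fin m → ℕ} →
  (∀ i → P i ≡ Q i) → (∀ i → g i ≡ h i) → sumWhere P g ≡ sumWhere Q h
sumWhere-cong {P = P} {Q} {g} {h} P≗Q g≗h = begin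
  sumWhere P g                        ≡⟨ sumWhere≡∑ P g ⟩
  ∑[ i < _ ] (if P i then g i else 0) ≡⟨ sum-cong-≗ (λ i → cong₂ (λ b n → if b then n else 0) (P≗Q i) (g≗h i)) ⟩
  ∑[ i < _ ] (if Q i then h i else 0) ≡⟨ sym (sumWhere≡∑ Q h) ⟩
  sumWhere Q h                        ∎
  where open ≡-Reasoning

sumWhere-mono-≤ : ∀ {m} (P : Fin m → Bool) {g h : Fin m → ℕ} → (∀ i → g i ≤ h i) →
  sumWhere P g ≤ sumWhere P h
sumWhere-mono-≤ P {g} {h} g≤h = begin
  sumWhere P g                        ≡⟨ sumWhere≡∑ P g ⟩
  ∑[ i < _ ] (if P i then g i else 0) ≤⟨ ∑-mono-≤ (λ i → pointwise (P i) (g≤h i)) ⟩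
  ∑[ i < _ ] (if P i then h i else 0) ≡⟨ sym (sumWhere≡∑ P h) ⟩
  sumWhere P h                        ∎
  where
  open ≤-Reasoning
  pointwise : ∀ b {x y} → x ≤ y → (if b then x else 0) ≤ (if b then y else 0)
  pointwise true  x≤y = x≤y
  pointwise false _   = z≤n

sumWhere-+ : ∀ {m} (P : Fin m → Bool) (g h : Fin m → ℕ) →
  sumWhere P (λ i → g i + h i) ≡ sumWhere P g + sumWhere P h
sumWhere-+ P g h = begin
  sumWhere P (λ i → g i + h i)
    ≡⟨ sumWhere≡∑ P _ ⟩
  ∑[ i < _ ] (if P i then g i + h i else 0)
    ≡⟨ sum-cong-≗ (λ i → pointwise (P i)) ⟩
  ∑[ i < _ ] ((if P i then g i else 0) + (if P i then h i else 0))
    ≡⟨ ∑-distrib-+ (λ i → if P i then g i else 0) (λ i → if P i then h i else 0) ⟩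
  ∑[ i < _ ] (if P i then g i else 0) + ∑[ i < _ ] (if P i then h i else 0)
    ≡⟨ sym (cong₂ _+_ (sumWhere≡∑ P g) (sumWhere≡∑ P h)) ⟩
  sumWhere P g + sumWhere P h
    ∎
  where
  open ≡-Reasoning
  pointwise : ∀ b {x y} → (if b then x + y else 0) ≡ (if b then x else 0) + (if b then y else 0)
  pointwise true  = refl
  pointwise false = refl

sumWhere-≤-+∸ : ∀ {m} (P : Fin m → Bool) (g c : Fin m → ℕ) →
  sumWhere P g ≤ sumWhere P c + sumWhere P (λ i → g i ∸ c i)
sumWhere-≤-+∸ P g c =
  ≤-trans (sumWhere-mono-≤ P (λ i → m≤n+m∸n (g i) (c i))) (≤-reflexive (sumWhere-+ P c _))

-- Double counting over the pairs (i , j) with P i ∧ R i j.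
sumWhere-count-≤ : ∀ {m n} {P : Fin m → Bool} {R : Fin m → Fin n → Bool} {Q : Fin n → Bool} →
  (∀ j → count (λ i → P i ∧ R i j) ≤ 𝟙 (Q j)) → sumWhere P (λ i → count (R i)) ≤ count Q
sumWhere-count-≤ {m} {n} {P} {R} {Q} fibre = begin
  sumWhere P (λ i → count (R i))               ≡⟨ sumWhere≡∑ P _ ⟩
  ∑[ i < m ] (if P i then count (R i) else 0)  ≡⟨ sum-cong-≗ (λ i → restrict (P i) i) ⟩
  ∑[ i < m ] ∑[ j < n ] 𝟙 (P i ∧ R i j)        ≡⟨ ∑-comm (λ i j → 𝟙 (P i ∧ R i j)) ⟩
  ∑[ j < n ] ∑[ i < m ] 𝟙 (P i ∧ R i j)        ≡⟨ sum-cong-≗ (λ j → sym (count≡∑𝟙 (λ i → P i ∧ R i j))) ⟩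
  ∑[ j < n ] count (λ i → P i ∧ R i j)         ≤⟨ ∑-mono-≤ fibre ⟩
  ∑[ j < n ] 𝟙 (Q j)                           ≡⟨ sym (count≡∑𝟙 Q) ⟩
  count Q                                      ∎
  where
  open ≤-Reasoning
  restrict : ∀ b i → (if b then count (R i) else 0) ≡ ∑[ j < n ] 𝟙 (b ∧ R i j)
  restrict true  i = count≡∑𝟙 (R i)
  restrict false i = sym (sum-replicate-zero n)

count-≤-injective : ∀ {m n} {P : Fin m → Bool} {Q : Fin n → Bool} (g : Fin m → Fin n) →
  (∀ i → P i ≡ true → Q (g i) ≡ true) →
  (∀ i j → P i ≡ true → P j ≡ true → g i ≡ g j → i ≡ j) →
  count P ≤ count Q
count-≤-injective {P = P} {Q} g P⇒Q∘g g-injective = begin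
  count P
    ≤⟨ sumWhere-mono-≤ P (λ i → count-positive (g i ==_) (g i) (==-refl (g i))) ⟩
  sumWhere P (λ i → count (g i ==_))
    ≤⟨ sumWhere-count-≤ {R = λ i → g i ==_} fibre ⟩
  count Q
    ∎
  where
  open ≤-Reasoning
  fibre : ∀ w → count (λ i → P i ∧ (g i == w)) ≤ 𝟙 (Q w)
  fibre w = count-≤-𝟙 unique
    (λ i e → let Pᵢ , gᵢ≡w = in-fibre e in subst (λ u → Q u ≡ true) gᵢ≡w (P⇒Q∘g i Pᵢ))
    where
    in-fibre : ∀ {i} → P i ∧ (g i == w) ≡ true → P i ≡ true × g i ≡ w
    in-fibre {i} e = let Pᵢ , gᵢ==w = ∧-true⁻ (P i) e in Pᵢ , ==⇒≡ gᵢ==w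
    unique : AtMostOne (λ i → P i ∧ (g i == w))
    unique i j eᵢ eⱼ =
      let Pᵢ , gᵢ≡w = in-fibre eᵢ ; Pⱼ , gⱼ≡w = in-fibre eⱼ
      in g-injective i j Pᵢ Pⱼ (trans gᵢ≡w (sym gⱼ≡w))

data Orientation : Set where
  outgoing incoming : Orientation

orient : Orientation → {A : Set} → (A → A → Bool) → A → A → Bool
orient outgoing R = R
orient incoming R = flip R

component : Orientation → ℕ × ℕ → ℕ
component outgoing = proj₁
component incoming = proj₂

deg : Orientation → (G : Digraph) → Fin (size G) → ℕ
deg d G v = count (orient d (adj G) v)

vert-delete⁻ : ∀ (G : Digraph) S {v} → vert (delete G S) v ≡ true → vert G v ≡ true × S v ≡ false
vert-delete⁻ G S e = let v∈G , v∉S = ∧-true⁻ (vert G _) e in v∈G , not-injective v∉S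

adj-delete⁻ : ∀ (G : Digraph) S {x y} → adj (delete G S) x y ≡ true →
  adj G x y ≡ true × S x ≡ false × S y ≡ false
adj-delete⁻ G S {x} {y} e with vert G x | S x | vert G y | S y | arc G x y
... | true  | false | true  | false | true  = refl , refl , refl
... | false | _     | _     | _     | _     = case e of λ ()
... | true  | true  | _     | _     | _     = case e of λ ()
... | true  | false | false | _     | _     = case e of λ ()
... | true  | false | true  | true  | _     = case e of λ ()
... | true  | false | true  | false | false = case e of λ ()

orient-adj-delete⁻ : ∀ d (G : Digraph) S {x y} → orient d (adj (delete G S)) x y ≡ true →
  orient d (adj G) x y ≡ true × S y ≡ false
orient-adj-delete⁻ outgoing G S e = let a , _ , y∉S = adj-delete⁻ G S e in a , y∉S
orient-adj-delete⁻ incoming G S e = let a , y∉S , _ = adj-delete⁻ G S e in a , y∉S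

deg-delete : ∀ d (G : Digraph) S {v} →
  count (λ w → orient d (adj G) v w ∧ S w) + deg d (delete G S) v ≤ deg d G v
deg-delete d G S {v} = +-count-≤
  (λ w e → proj₁ (∧-true⁻ (orient d (adj G) v w) e))
  (λ w e → proj₁ (orient-adj-delete⁻ d G S e))
  (λ w e e′ → true≢false (trans (sym (proj₂ (∧-true⁻ (orient d (adj G) v w) e)))
                                (proj₂ (orient-adj-delete⁻ d G S e′))))

residualWeight : (G : Digraph) → (Fin (size G) → Bool) → (Fin (size G) → ℕ × ℕ) → Fin (size G) → ℕ × ℕ
residualWeight G T f x =
  proj₁ (f x) ∸ count (λ y → T y ∧ adj G x y) , proj₂ (f x) ∸ count (λ y → T y ∧ adj G y x)

component-residualWeight : ∀ d (G : Digraph) T f x →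
  component d (residualWeight G T f x) ≡ component d (f x) ∸ count (λ y → T y ∧ orient d (adj G) x y)
component-residualWeight outgoing G T f x = refl
component-residualWeight incoming G T f x = refl

DegreeBound : Orientation → (K : Config) → Fin (size (D K)) → Set
DegreeBound d K v = deg d (D K) v ≤ sumWhere (inX K v) (component d ∘ f K)

module _ (K : Config) where

  inX⁻ : ∀ {v x} → inX K v x ≡ true → vert (H K) x ≡ true × p K x ≡ v
  inX⁻ {x = x} e = let x∈H , p≡v = ∧-true⁻ (vert (H K) x) e in x∈H , ==⇒≡ p≡v

  inX-reduce : ∀ {T v} → vert (D′ K T) v ≡ true → ∀ x → inX (reduce K T) v x ≡ inX K v x
  inX-reduce {T} {v} v∈D′ x with p K x ≟ v
  ... | yes refl rewrite v∈D′ = cong (_∧ true) (∧-identityʳ (vert (H K) x))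
  ... | no _                  = trans (∧-zeroʳ _) (sym (∧-zeroʳ _))

  module _ (T : Fin (size (H K)) → Bool) where

    dom-intro : PartialTransversal K T → ∀ {y} → T y ≡ true → dom K T (p K y) ≡ true
    dom-intro (T⊆H , _) {y} y∈T =
      anyFin-intro (λ x → T x ∧ inX K (p K y) x) y
        (cong₂ _∧_ y∈T (cong₂ _∧_ (T⊆H y y∈T) (==-refl (p K y))))

    dom-elim : ∀ {v} → dom K T v ≡ true → ∃ λ x → T x ≡ true × p K x ≡ v
    dom-elim {v} e =
      let x , e′ = anyFin-elim (λ x → T x ∧ inX K v x) e
          x∈T , x∈Xᵥ = ∧-true⁻ (T x) e′
      in x , x∈T , proj₂ (inX⁻ x∈Xᵥ)

module _ {K : Config} (cover : IsCover K) where
  open IsCover cover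

  orient-matching : ∀ d {x x′ y} → orient d (adj (H K)) x y ≡ true → orient d (adj (H K)) x′ y ≡ true →
    p K x ≡ p K x′ → x ≡ x′
  orient-matching outgoing = match-head _ _ _
  orient-matching incoming = match-tail _ _ _

  orient-arc : ∀ d {x y} → orient d (adj (H K)) x y ≡ true → orient d (adj (D K)) (p K x) (p K y) ≡ true
  orient-arc outgoing a = arcs-over _ _ a (independent _ _ a)
  orient-arc incoming a = arcs-over _ _ a (independent _ _ a)

  module _ {T : Fin (size (H K)) → Bool} (T-partial : PartialTransversal K T) (d : Orientation)
           {v : Fin (size (D K))} where

    arcs-into-T≤arcs-into-dom :
      sumWhere (inX K v) (λ x → count (λ y → T y ∧ orient d (adj (H K)) x y))
        ≤ count (λ w → orient d (adj (D K)) v w ∧ dom K T w)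
    arcs-into-T≤arcs-into-dom =
      ≤-trans (sumWhere-count-≤ {R = λ x y → T y ∧ Arc x y} fibre)
              (count-≤-injective (p K) over-dom p-injective)
      where
      Arc : Fin (size (H K)) → Fin (size (H K)) → Bool
      Arc = orient d (adj (H K))

      over-dom : ∀ y → T y ∧ orient d (adj (D K)) v (p K y) ≡ true →
        orient d (adj (D K)) v (p K y) ∧ dom K T (p K y) ≡ true
      over-dom y e = let y∈T , a = ∧-true⁻ (T y) e in cong₂ _∧_ a (dom-intro K T T-partial y∈T)

      p-injective : ∀ y y′ → T y ∧ orient d (adj (D K)) v (p K y) ≡ true →
        T y′ ∧ orient d (adj (D K)) v (p K y′) ≡ true → p K y ≡ p K y′ → y ≡ y′
      p-injective y y′ e e′ = proj₂ T-partial y y′ (proj₁ (∧-true⁻ (T y) e)) (proj₁ (∧-true⁻ (T y′) e′))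

      fibre : ∀ y → count (λ x → inX K v x ∧ (T y ∧ Arc x y)) ≤ 𝟙 (T y ∧ orient d (adj (D K)) v (p K y))
      fibre y = count-≤-𝟙 unique lies-over
        where
        in-fibre : ∀ {x} → inX K v x ∧ (T y ∧ Arc x y) ≡ true → p K x ≡ v × T y ≡ true × Arc x y ≡ true
        in-fibre {x} e =
          let x∈Xᵥ , e′ = ∧-true⁻ (inX K v x) e ; y∈T , a = ∧-true⁻ (T y) e′
          in proj₂ (inX⁻ K x∈Xᵥ) , y∈T , a

        unique : AtMostOne (λ x → inX K v x ∧ (T y ∧ Arc x y))
        unique x x′ e e′ =
          let pₓ≡v , _ , a = in-fibre e ; pₓ′≡v , _ , a′ = in-fibre e′
          in orient-matching d a a′ (trans pₓ≡v (sym pₓ′≡v))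

        lies-over : ∀ x → inX K v x ∧ (T y ∧ Arc x y) ≡ true → T y ∧ orient d (adj (D K)) v (p K y) ≡ true
        lies-over x e =
          let pₓ≡v , y∈T , a = in-fibre e
          in cong₂ _∧_ y∈T (subst (λ u → orient d (adj (D K)) u (p K y) ≡ true) pₓ≡v (orient-arc d a))

    DegreeBound-reduce : vert (D′ K T) v ≡ true → DegreeBound d K v → DegreeBound d (reduce K T) v
    DegreeBound-reduce v∈D′ bound = +-cancelˡ-≤ E _ _ (begin
      E + deg d (D′ K T) v                       ≤⟨ deg-delete d (D K) (dom K T) ⟩
      deg d (D K) v                              ≤⟨ bound ⟩
      sumWhere (inX K v) (component d ∘ f K)     ≤⟨ sumWhere-≤-+∸ (inX K v) (component d ∘ f K) c ⟩
      C + sumWhere (inX K v) (λ x → component d (f K x) ∸ c x)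
        ≡⟨ cong (C +_) (sumWhere-cong (λ x → sym (inX-reduce K {T} v∈D′ x))
                                      (λ x → sym (component-residualWeight d (H K) T (f K) x))) ⟩
      C + F′                                     ≤⟨ +-monoˡ-≤ F′ arcs-into-T≤arcs-into-dom ⟩
      E + F′                                     ∎)
      where
      open ≤-Reasoning
      c : Fin (size (H K)) → ℕ
      c x = count (λ y → T y ∧ orient d (adj (H K)) x y)
      C E F′ : ℕ
      C  = sumWhere (inX K v) c
      E  = count (λ w → orient d (adj (D K)) v w ∧ dom K T w)
      F′ = sumWhere (inX (reduce K T) v) (component d ∘ f (reduce K T))

  DegreeFeasible-reduce : ∀ {T} → PartialTransversal K T → DegreeFeasible K → DegreeFeasible (reduce K T)
  DegreeFeasible-reduce {T} T-partial feasible v v∈D′ =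
    DegreeBound-reduce T-partial outgoing v∈D′ (proj₁ (feasible v v∈D)) ,
    DegreeBound-reduce T-partial incoming v∈D′ (proj₂ (feasible v v∈D))
    where
    v∈D : vert (D K) v ≡ true
    v∈D = proj₁ (vert-delete⁻ (D K) (dom K T) v∈D′)

m<n∸o⇒m+o<n : ∀ m n o → m < n ∸ o → m + o < n
m<n∸o⇒m+o<n m n       zero    lt rewrite +-identityʳ m = lt
m<n∸o⇒m+o<n m (suc n) (suc o) lt rewrite +-suc m o     = s≤s (m<n∸o⇒m+o<n m n o lt)

vert-induced-∪⁻ : ∀ (G : Digraph) (T T′ : Fin (size G) → Bool) {x} →
  vert (induced G (λ y → T y ∨ T′ y)) x ≡ true → vert G x ≡ true × (T x ≡ true ⊎ T′ x ≡ true)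
vert-induced-∪⁻ G T T′ {x} e = let x∈G , x∈T∪T′ = ∧-true⁻ (vert G x) e in x∈G , ∨-true⁻ (T x) x∈T∪T′

StrictlyDegenerate-∪ : ∀ (G : Digraph) f {T T′ U : Fin (size G) → Bool} →
  (∀ x → T′ x ≡ true → U x ≡ true) →
  StrictlyDegenerate (induced G T) f →
  StrictlyDegenerate (induced (induced G U) T′) (residualWeight G T f) →
  StrictlyDegenerate (induced G (λ x → T x ∨ T′ x)) f
StrictlyDegenerate-∪ G f {T} {T′} {U} T′⊆U degenerate degenerate′ S B S⊆ B⊆ nonempty
  with any? (λ x → S x ∧ T′ x Data.Bool.≟ true)
... | no S∩T′=∅ = degenerate S B S⊆T B⊆ nonempty
  where
  S⊆T : ∀ x → S x ≡ true → vert G x ∧ T x ≡ true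
  S⊆T x x∈S with vert-induced-∪⁻ G T T′ (S⊆ x x∈S)
  ... | x∈G , inj₁ x∈T  = cong₂ _∧_ x∈G x∈T
  ... | _   , inj₂ x∈T′ = ⊥-elim (S∩T′=∅ (x , cong₂ _∧_ x∈S x∈T′))
... | yes S∩T′≠∅ =
  let x , x∈S′ , sparse′ = degenerate′ S′ B′ S′⊆ B′⊆ S∩T′≠∅
  in x , proj₁ (∧-true⁻ (S x) x∈S′) , ⊎-map (lift outgoing x∈S′) (lift incoming x∈S′) sparse′
  where
  classify : ∀ {y} → S y ≡ true → vert G y ≡ true × (T y ≡ true ⊎ T′ y ≡ true)
  classify {y} y∈S = vert-induced-∪⁻ G T T′ (S⊆ y y∈S)
  S′ : Fin (size G) → Bool
  S′ x = S x ∧ T′ x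
  B′ : Fin (size G) → Fin (size G) → Bool
  B′ x y = T′ x ∧ T′ y ∧ B x y
  S′⊆ : ∀ x → S′ x ≡ true → (vert G x ∧ U x) ∧ T′ x ≡ true
  S′⊆ x e = let x∈S , x∈T′ = ∧-true⁻ (S x) e in
    cong₂ _∧_ (cong₂ _∧_ (proj₁ (classify x∈S)) (T′⊆U x x∈T′)) x∈T′
  B′⊆ : ∀ x y → B′ x y ≡ true → S′ x ≡ true × S′ y ≡ true × arc G x y ≡ true
  B′⊆ x y e = let x∈T′ , e′ = ∧-true⁻ (T′ x) e ; y∈T′ , xy∈B = ∧-true⁻ (T′ y) e′
                  x∈S , y∈S , a = B⊆ x y xy∈B
              in cong₂ _∧_ x∈S x∈T′ , cong₂ _∧_ y∈S y∈T′ , a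
  split : ∀ d {x} → T′ x ≡ true → ∀ y → orient d B x y ≡ true →
    orient d B′ x y ≡ true ⊎ T y ∧ orient d (adj G) x y ≡ true
  split outgoing {x} x∈T′ y xy∈B with B⊆ x y xy∈B
  ... | x∈S , y∈S , a with classify y∈S
  ...   | y∈G , inj₁ y∈T  = inj₂ (cong₂ _∧_ y∈T (cong₂ _∧_ (proj₁ (classify x∈S)) (cong₂ _∧_ y∈G a)))
  ...   | _   , inj₂ y∈T′ = inj₁ (cong₂ _∧_ x∈T′ (cong₂ _∧_ y∈T′ xy∈B))
  split incoming {x} x∈T′ y yx∈B with B⊆ y x yx∈B
  ... | y∈S , x∈S , a with classify y∈S
  ...   | y∈G , inj₁ y∈T  = inj₂ (cong₂ _∧_ y∈T (cong₂ _∧_ y∈G (cong₂ _∧_ (proj₁ (classify x∈S)) a)))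
  ...   | _   , inj₂ y∈T′ = inj₁ (cong₂ _∧_ y∈T′ (cong₂ _∧_ x∈T′ yx∈B))
  lift : ∀ d {x} → S′ x ≡ true → count (orient d B′ x) < component d (residualWeight G T f x) →
    count (orient d B x) < component d (f x)
  lift d {x} x∈S′ sparse′ = begin-strict
    count (orient d B x)             ≤⟨ count-≤-+ (split d (proj₂ (∧-true⁻ (S x) x∈S′))) ⟩
    count (orient d B′ x) + Tₓ       <⟨ m<n∸o⇒m+o<n _ _ Tₓ sparse ⟩
    component d (f x)                ∎
    where
    open ≤-Reasoning
    Tₓ : ℕ
    Tₓ = count (λ y → T y ∧ orient d (adj G) x y)
    sparse : count (orient d B′ x) < component d (f x) ∸ Tₓ
    sparse = subst (count (orient d B′ x) <_) (component-residualWeight d G T f x) sparse′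

module _ (K : Config) {T : Fin (size (H K)) → Bool} (T-partial : PartialTransversal K T) where

  outside-dom : ∀ {T′} → PartialTransversal (reduce K T) T′ → ∀ {y} → T′ y ≡ true →
    vert (H K) y ≡ true × dom K T (p K y) ≡ false
  outside-dom (T′⊆H′ , _) {y} y∈T′ =
    let y∈H , p[y]∈D′ = ∧-true⁻ (vert (H K) y) (T′⊆H′ y y∈T′)
    in y∈H , proj₂ (vert-delete⁻ (D K) (dom K T) p[y]∈D′)

  Transversal-∪ : ∀ {T′} → Transversal (reduce K T) T′ → Transversal K (λ x → T x ∨ T′ x)
  Transversal-∪ {T′} (T′-partial@(_ , T′-unique) , T′-covers) = (⊆H , unique) , covers
    where
    T∩T′=∅ : ∀ {x y} → T x ≡ true → T′ y ≡ true → p K x ≢ p K y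
    T∩T′=∅ x∈T y∈T′ pₓ≡p[y] = true≢false (trans (sym (dom-intro K T T-partial x∈T))
      (trans (cong (dom K T) pₓ≡p[y]) (proj₂ (outside-dom T′-partial y∈T′))))

    ⊆H : ∀ x → T x ∨ T′ x ≡ true → vert (H K) x ≡ true
    ⊆H x e with ∨-true⁻ (T x) e
    ... | inj₁ x∈T  = proj₁ T-partial x x∈T
    ... | inj₂ x∈T′ = proj₁ (outside-dom T′-partial x∈T′)

    unique : ∀ x y → T x ∨ T′ x ≡ true → T y ∨ T′ y ≡ true → p K x ≡ p K y → x ≡ y
    unique x y x∈T∪T′ y∈T∪T′ pₓ≡p[y] with ∨-true⁻ (T x) x∈T∪T′ | ∨-true⁻ (T y) y∈T∪T′
    ... | inj₁ x∈T  | inj₁ y∈T  = proj₂ T-partial x y x∈T y∈T pₓ≡p[y]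
    ... | inj₂ x∈T′ | inj₂ y∈T′ = T′-unique x y x∈T′ y∈T′ pₓ≡p[y]
    ... | inj₁ x∈T  | inj₂ y∈T′ = ⊥-elim (T∩T′=∅ x∈T y∈T′ pₓ≡p[y])
    ... | inj₂ x∈T′ | inj₁ y∈T  = ⊥-elim (T∩T′=∅ y∈T x∈T′ (sym pₓ≡p[y]))

    covers : ∀ v → vert (D K) v ≡ true → ∃ λ x → T x ∨ T′ x ≡ true × p K x ≡ v
    covers v v∈D with dom K T v in v∈dom?
    ... | true  = let x , x∈T , pₓ≡v = dom-elim K T v∈dom? in x , ∨-trueˡ x∈T , pₓ≡v
    ... | false = let x , x∈T′ , pₓ≡v = T′-covers v (cong₂ _∧_ v∈D (cong not v∈dom?))
                  in x , ∨-trueʳ (T x) x∈T′ , pₓ≡v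

  reduce-Colorable⇒Colorable : StrictlyDegenerate (induced (H K) T) (f K) →
    Colorable (reduce K T) → Colorable K
  reduce-Colorable⇒Colorable degenerate (T′ , T′-transversal@((T′⊆H′ , _) , _) , degenerate′) =
    _ , Transversal-∪ T′-transversal ,
    StrictlyDegenerate-∪ (H K) (f K) (λ x x∈T′ → proj₂ (∧-true⁻ (vert (H K) x) (T′⊆H′ x x∈T′)))
      degenerate degenerate′

proposition18 : (K : Config) → IsCover K →
    (T : Fin (size (H K)) → Bool) →
    PartialTransversal K T →
    StrictlyDegenerate (induced (H K) T) (f K) →
    Connected (D′ K T) →
    (DegreeFeasible K → DegreeFeasible (reduce K T)) ×
    (Uncolorable K → Uncolorable (reduce K T))
proposition18 K cover T T-partial degenerate _ =
  DegreeFeasible-reduce cover T-partial ,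
  λ uncolorable colorable′ → uncolorable (reduce-Colorable⇒Colorable K T-partial degenerate colorable′)
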